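{- Let $\mathcal{H}$ be a hypergraph on a finite set $\Omega$. Then: (1) if $F\subseteq\Omega$ is an $\mathcal{R}_2$-forcing set, then $F$ is also an $\mathcal{R}_1$-forcing set; moreover, for every inclusion-minimal $\mathcal{R}_2$-forcing set $F$ there exists an inclusion-minimal $\mathcal{R}_1$-forcing set $F'$ with $F'\subseteq F$. (2) If $I\subseteq\Omega$ is an $\mathcal{R}_1$-immune set, then $I$ is also an $\mathcal{R}_2$-immune set; moreover, for every inclusion-minimal $\mathcal{R}_1$-immune set $I$ there exists an inclusion-minimal $\mathcal{R}_2$-immune set $I'$ with $I'\subseteq I$.
   Context: A hypergraph $\mathcal{H}$ on a finite set $\Omega$ has vertex set $\Omega$ and a set of hyperedges, which are subsets of $\Omega$ forming a clutter (no hyperedge contains another). Two vertex subsets $X,Y$ are adjacent if some hyperedge contains both; a vertex $v$ is adjacent to $X$ if $\{v\}$ and $X$ are adjacent. Vertices are colored black or white. Rule $\mathcal{R}_1$: at each step, a non-empty set $X$ of black vertices contained in a hyperedge $E$, such that no white vertex outside $E$ is adjacent to $X$, forces all white vertices of $E$ to become black. Rule $\mathcal{R}_2$: at each step, a non-empty set $X$ of black vertices contained in a hyperedge $E$, such that $X$ is not contained in any other hyperedge containing white vertices, forces all white vertices of $E$ to become black. Starting from an initial black set $B$ and applying $\mathcal{R}_i$ until no more changes are possible, the final black set is independent of the order of steps; denote it $\mathcal{R}_i^\ast(B)$. An $\mathcal{R}_i$-forcing set is a non-empty $F\subseteq\Omega$ with $\mathcal{R}_i^\ast(F)=\Omega$;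 an $\mathcal{R}_i$-immune set is a non-empty $I\subseteq\Omega$ with $\mathcal{R}_i^\ast(\Omega\setminus I)=\Omega\setminus I$. -}

module Defs where

open import Data.Nat using (ℕ)
open import Data.Fin using (Fin)
open import Data.Fin.Subset using (Subset; _∈_; _∉_; _⊆_; _∪_; ∁; ⊤; Nonempty)
open import Data.Product using (Σ; _×_; ∃; ∃-syntax)
open import Relation.Binary.PropositionalEquality using (_≡_; _≢_)
open import Relation.Nullary using (¬_)

record Hypergraph (n : ℕ) : Set where
  field
    m       : ℕ
    edge    : Fin m → Subset n
    clutter : ∀ i j → i ≢ j → ¬ (edge i ⊆ edge j)

module _ {n : ℕ} (H : Hypergraph n) where
  open Hypergraph H

  AdjacentSets : Subset n → Subset n → Set
  AdjacentSets X Y = ∃[ k ] (X ⊆ edge k × Y ⊆ edge k)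

  AdjacentV : Fin n → Subset n → Set
  AdjacentV v X = ∃[ k ] (v ∈ edge k × X ⊆ edge k)

  -- Applicability of rule R₁ with black set B, forcing set X, hyperedge index i.
  R₁-applicable : Subset n → Subset n → Fin m → Set
  R₁-applicable B X i =
    Nonempty X × X ⊆ B × X ⊆ edge i ×
    (∀ v → v ∉ B → v ∉ edge i → ¬ AdjacentV v X)

  R₂-applicable : Subset n → Subset n → Fin m → Set
  R₂-applicable B X i =
    Nonempty X × X ⊆ B × X ⊆ edge i ×
    (∀ j → j ≢ i → X ⊆ edge j → ¬ (∃[ w ] (w ∈ edge j × w ∉ B)))

  Rule : Set₁
  Rule = Subset n → Subset n → Fin m → Set

  data Step (R : Rule) : Subset n → Subset n → Set where
    step : ∀ {B} X i → R B X i → Step R B (B ∪ edge i)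

  data Steps (R : Rule) : Subset n → Subset n → Set where
    done : ∀ {B} → Steps R B B
    more : ∀ {B C D} → Step R B C → Steps R C D → Steps R B D

  Stable : Rule → Subset n → Set
  Stable R C = ∀ X i → R C X i → edge i ⊆ C

  -- C = R*(B): the final black set obtained by applying R until no changes
  -- (well-defined since the result is order-independent).
  Closure : Rule → Subset n → Subset n → Set
  Closure R B C = Steps R B C × Stable R C

  IsForcing : Rule → Subset n → Set
  IsForcing R F = Nonempty F × Closure R F ⊤

  IsImmune : Rule → Subset n → Set
  IsImmune R I = Nonempty I × Closure R (∁ I) (∁ I)

  Minimal : (Subset n → Set) → Subset n → Set
  Minimal P F = P F × (∀ G → G ⊆ F → P G → F ⊆ G)

-- Every R₂-move is an R₁-move: a white vertex outside E that is adjacent to X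
-- lies in a hyperedge E′ ≠ E containing X, and R₂ forbids exactly such E′.
-- Hence an R₂-derivation is an R₁-derivation, so R₂-forcing sets are
-- R₁-forcing, and a black set stable under R₁ is stable under R₂, so
-- R₁-immune sets are R₂-immune. Both properties are decidable on the finite
-- set Ω, since an effective step adds a vertex and derivations can be searched
-- with |Ω| as fuel; so below any set with the property lies a minimal one.
module Submission where

open import Defs
open import Data.Nat using (ℕ; zero; suc; _+_; _≤_; _<_)
open import Data.Nat.Properties
  using (≤-refl; ≤-trans; ≤-pred; <-≤-trans; ≤-<-trans; <-irrefl; +-suc; +-monoʳ-≤; m≤m+n)
import Data.Fin.Properties as Fin
open import Data.Fin.Subset using (Subset; _⊆_; _⊂_; _∪_; ⊤; ∁; ∣_∣)
open import Data.Fin.Subset.Properties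
  using (_⊆?_; _⊂?_; _∈?_; nonempty?; anySubset?; ⊆⊤; ⊆-antisym; p⊆p∪q; x∈p∪q⁺;
         p⊆q⇒∣p∣≤∣q∣; p⊂q⇒∣p∣<∣q∣; ∣⊤∣≡n)
open import Data.Product using (_×_; ∃; ∃-syntax; _,_; proj₁)
open import Data.Sum using (_⊎_; inj₁; inj₂)
open import Data.Empty using (⊥-elim)
open import Function using (_∘_)
open import Data.Vec.Properties using (≡-dec)
import Data.Bool.Properties as Bool
open import Relation.Nullary using (¬_; Dec; yes; no)
open import Relation.Nullary.Decidable using (_×-dec_; _⊎-dec_; _→-dec_; ¬?)
open import Relation.Unary using (Pred; Decidable)
open import Relation.Binary.PropositionalEquality using (_≡_; refl; sym; subst)

∪-stationary : ∀ {n} (B E : Subset n) → ¬ (B ⊂ B ∪ E) → B ∪ E ≡ B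
∪-stationary B E B⊄B∪E = ⊆-antisym B∪E⊆B (p⊆p∪q E)
  where
  B∪E⊆B : B ∪ E ⊆ B
  B∪E⊆B {x} x∈B∪E with x ∈? B
  ... | yes x∈B = x∈B
  ... | no  x∉B = ⊥-elim (B⊄B∪E (p⊆p∪q E , x , x∈B∪E , x∉B))

module _ {n : ℕ} (H : Hypergraph n) where
  open Hypergraph H

  minimal-⊆ : ∀ {P : Pred (Subset n) _} → Decidable P →
              ∀ {F} → P F → ∃[ F′ ] (F′ ⊆ F × Minimal H P F′)
  minimal-⊆ {P} P? {F} PF = search (suc ∣ F ∣) F ≤-refl PF
    where
    search : ∀ fuel F → ∣ F ∣ < fuel → P F → ∃[ F′ ] (F′ ⊆ F × Minimal H P F′)
    search (suc fuel) F ∣F∣<fuel PF with anySubset? (λ G → (G ⊂? F) ×-dec P? G)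
    ... | yes (G , G⊂F , PG) with search fuel G (≤-trans (p⊂q⇒∣p∣<∣q∣ G⊂F) (≤-pred ∣F∣<fuel)) PG
    ...   | F′ , F′⊆G , F′-minimal = F′ , (λ x∈F′ → proj₁ G⊂F (F′⊆G x∈F′)) , F′-minimal
    search (suc fuel) F _ PF | no no-smaller = F , (λ x∈F → x∈F) , PF , F-minimal
      where
      F-minimal : ∀ G → G ⊆ F → P G → F ⊆ G
      F-minimal G G⊆F PG {x} x∈F with x ∈? G
      ... | yes x∈G = x∈G
      ... | no  x∉G = ⊥-elim (no-smaller (G , (G⊆F , x , x∈F , x∉G) , PG))

  _⊆ᴿ_ : Rule H → Rule H → Set
  R ⊆ᴿ R′ = ∀ B X i → R B X i → R′ B X i

  R₂⊆ᴿR₁ : R₂-applicable H ⊆ᴿ R₁-applicable H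
  R₂⊆ᴿR₁ B X i (X≢∅ , X⊆B , X⊆Eᵢ , no-other-white-edge) =
    X≢∅ , X⊆B , X⊆Eᵢ ,
    λ v v∉B v∉Eᵢ (k , v∈Eₖ , X⊆Eₖ) →
      no-other-white-edge k (λ { refl → v∉Eᵢ v∈Eₖ }) X⊆Eₖ (v , v∈Eₖ , v∉B)

  Steps-mono : ∀ {R R′} → R ⊆ᴿ R′ → ∀ {B C} → Steps H R B C → Steps H R′ B C
  Steps-mono R⊆R′ done                   = done
  Steps-mono R⊆R′ (more (step X i r) ss) = more (step X i (R⊆R′ _ X i r)) (Steps-mono R⊆R′ ss)

  Stable-antitone : ∀ {R R′} → R ⊆ᴿ R′ → ∀ {C} → Stable H R′ C → Stable H R C
  Stable-antitone R⊆R′ stable X i r = stable X i (R⊆R′ _ X i r)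

  Stable-⊤ : ∀ R → Stable H R ⊤
  Stable-⊤ R X i _ = ⊆⊤

  IsForcing-mono : ∀ {R R′} → R ⊆ᴿ R′ → ∀ {F} → IsForcing H R F → IsForcing H R′ F
  IsForcing-mono {R′ = R′} R⊆R′ (F≢∅ , ss , _) = F≢∅ , Steps-mono R⊆R′ ss , Stable-⊤ R′

  IsImmune-antitone : ∀ {R R′} → R ⊆ᴿ R′ → ∀ {I} → IsImmune H R′ I → IsImmune H R I
  IsImmune-antitone R⊆R′ (I≢∅ , _ , stable) = I≢∅ , done , Stable-antitone R⊆R′ stable

  R₁-applicable? : ∀ B X i → Dec (R₁-applicable H B X i)
  R₁-applicable? B X i = nonempty? X ×-dec (X ⊆? B) ×-dec (X ⊆? edge i) ×-dec
    Fin.all? (λ v → ¬? (v ∈? B) →-dec ¬? (v ∈? edge i) →-dec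
      ¬? (Fin.any? (λ k → (v ∈? edge k) ×-dec (X ⊆? edge k))))

  R₂-applicable? : ∀ B X i → Dec (R₂-applicable H B X i)
  R₂-applicable? B X i = nonempty? X ×-dec (X ⊆? B) ×-dec (X ⊆? edge i) ×-dec
    Fin.all? (λ j → ¬? (j Fin.≟ i) →-dec (X ⊆? edge j) →-dec
      ¬? (Fin.any? (λ w → (w ∈? edge j) ×-dec ¬? (w ∈? B))))

  module _ (R : Rule H) (R? : ∀ B X i → Dec (R B X i)) where

    StepsWithin : ℕ → Subset n → Subset n → Set
    StepsWithin zero      B C = B ≡ C
    StepsWithin (suc len) B C =
      B ≡ C ⊎ ∃ λ X → ∃ λ i → R B X i × StepsWithin len (B ∪ edge i) C

    StepsWithin? : ∀ len B C → Dec (StepsWithin len B C)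
    StepsWithin? zero      B C = ≡-dec Bool._≟_ B C
    StepsWithin? (suc len) B C = ≡-dec Bool._≟_ B C ⊎-dec
      anySubset? (λ X → Fin.any? (λ i → R? B X i ×-dec StepsWithin? len (B ∪ edge i) C))

    StepsWithin-refl : ∀ len B → StepsWithin len B B
    StepsWithin-refl zero      B = refl
    StepsWithin-refl (suc len) B = inj₁ refl

    StepsWithin⇒Steps : ∀ len {B C} → StepsWithin len B C → Steps H R B C
    StepsWithin⇒Steps zero      refl                = done
    StepsWithin⇒Steps (suc len) (inj₁ refl)         = done
    StepsWithin⇒Steps (suc len) (inj₂ (X , i , r , ss)) =
      more (step X i r) (StepsWithin⇒Steps len ss)

    Steps⇒⊆ : ∀ {B C} → Steps H R B C → B ⊆ C
    Steps⇒⊆ done                   x∈B = x∈B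
    Steps⇒⊆ (more (step X i r) ss) x∈B = Steps⇒⊆ ss (x∈p∪q⁺ (inj₁ x∈B))

    -- Steps that add no vertex are dropped; every other step uses one unit of
    -- the available growth ∣ C ∣ − ∣ B ∣.
    Steps⇒StepsWithin : ∀ {B C} → Steps H R B C → ∀ len → ∣ C ∣ ≤ len + ∣ B ∣ →
                        StepsWithin len B C
    Steps⇒StepsWithin done len _ = StepsWithin-refl len _
    Steps⇒StepsWithin {B} {C} (more (step X i r) ss) len ∣C∣≤ with B ⊂? B ∪ edge i
    ... | no B⊄B∪Eᵢ = subst (λ B′ → StepsWithin len B′ C) B∪Eᵢ≡B
        (Steps⇒StepsWithin ss len (subst (λ B′ → ∣ C ∣ ≤ len + ∣ B′ ∣) (sym B∪Eᵢ≡B) ∣C∣≤))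
      where B∪Eᵢ≡B = ∪-stationary B (edge i) B⊄B∪Eᵢ
    ... | yes B⊂B∪Eᵢ with len
    ...   | zero = ⊥-elim (<-irrefl refl
        (<-≤-trans (≤-<-trans ∣C∣≤ (p⊂q⇒∣p∣<∣q∣ B⊂B∪Eᵢ)) (p⊆q⇒∣p∣≤∣q∣ (Steps⇒⊆ ss))))
    ...   | suc len′ = inj₂ (X , i , r , Steps⇒StepsWithin ss len′
        (≤-trans ∣C∣≤ (subst (_≤ len′ + ∣ B ∪ edge i ∣) (+-suc len′ ∣ B ∣)
          (+-monoʳ-≤ len′ (p⊂q⇒∣p∣<∣q∣ B⊂B∪Eᵢ)))))

    Steps? : ∀ B C → Dec (Steps H R B C)
    Steps? B C with StepsWithin? n B C
    ... | yes ss = yes (StepsWithin⇒Steps n ss)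
    ... | no ¬ss = no λ ss → ¬ss (Steps⇒StepsWithin ss n ∣C∣≤n+∣B∣)
      where
      ∣C∣≤n+∣B∣ : ∣ C ∣ ≤ n + ∣ B ∣
      ∣C∣≤n+∣B∣ = ≤-trans (p⊆q⇒∣p∣≤∣q∣ (⊆⊤ {p = C}))
                          (subst (_≤ n + ∣ B ∣) (sym (∣⊤∣≡n n)) (m≤m+n n ∣ B ∣))

    Stable? : ∀ C → Dec (Stable H R C)
    Stable? C with anySubset? (λ X → ¬? (Fin.all? (λ i → R? C X i →-dec (edge i ⊆? C))))
    ... | yes (X , unstable) = no λ stable → unstable (stable X)
    ... | no  ¬unstable      = yes λ X i r → stable-at X i r
      where
      stable-at : ∀ X i → R C X i → edge i ⊆ C
      stable-at X i r with Fin.all? (λ i → R? C X i →-dec (edge i ⊆? C))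
      ... | yes stable = stable i r
      ... | no  unstable = ⊥-elim (¬unstable (X , unstable))

    IsForcing? : Decidable (IsForcing H R)
    IsForcing? F = nonempty? F ×-dec Steps? F ⊤ ×-dec yes (Stable-⊤ R)

    IsImmune? : Decidable (IsImmune H R)
    IsImmune? I = nonempty? I ×-dec yes done ×-dec Stable? (∁ I)

proposition2 : ∀ {n : ℕ} (H : Hypergraph n) →
    ((∀ F → IsForcing H (R₂-applicable H) F → IsForcing H (R₁-applicable H) F) ×
     (∀ F → Minimal H (IsForcing H (R₂-applicable H)) F →
        ∃[ F′ ] (F′ ⊆ F × Minimal H (IsForcing H (R₁-applicable H)) F′))) ×
    ((∀ I → IsImmune H (R₁-applicable H) I → IsImmune H (R₂-applicable H) I) ×
     (∀ I → Minimal H (IsImmune H (R₁-applicable H)) I →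
        ∃[ I′ ] (I′ ⊆ I × Minimal H (IsImmune H (R₂-applicable H)) I′)))
proposition2 H = (R₂-forcing⇒R₁-forcing , λ F → minimal-⊆ H R₁-forcing? ∘ R₂-forcing⇒R₁-forcing F ∘ proj₁)
               , (R₁-immune⇒R₂-immune , λ I → minimal-⊆ H R₂-immune? ∘ R₁-immune⇒R₂-immune I ∘ proj₁)
  where
  R₂-forcing⇒R₁-forcing : ∀ F → IsForcing H (R₂-applicable H) F → IsForcing H (R₁-applicable H) F
  R₂-forcing⇒R₁-forcing F = IsForcing-mono H (R₂⊆ᴿR₁ H)

  R₁-immune⇒R₂-immune : ∀ I → IsImmune H (R₁-applicable H) I → IsImmune H (R₂-applicable H) I
  R₁-immune⇒R₂-immune I = IsImmune-antitone H (R₂⊆ᴿR₁ H)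

  R₁-forcing? : Decidable (IsForcing H (R₁-applicable H))
  R₁-forcing? = IsForcing? H (R₁-applicable H) (R₁-applicable? H)

  R₂-immune? : Decidable (IsImmune H (R₂-applicable H))
  R₂-immune? = IsImmune? H (R₂-applicable H) (R₂-applicable? H)
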